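{- Let $H$ be a graph and suppose that, for some $q\in\mathbb N$, the blowup $H\otimes J_q$ contains a matching-linked set $X$. Then $\gamma(H)\ge\frac13\cdot|X|/q$.
   Context: The blowup $H\otimes J_t$ has vertices $v^{(i)}$ ($v\in V(H)$, $i\in[t]$) and edges $u^{(i)}v^{(j)}$ for $uv\in E(H)$, $i,j\in[t]$, and $u^{(i)}u^{(j)}$ for $u\in V(H)$, $i\ne j$. A matching on a vertex set $X$ is a set of pairwise disjoint pairs $\{u,v\}$, $u\ne v$, $u,v\in X$ (not necessarily edges). For a graph $H'$, $X\subseteq V(H')$ is matching-linked if for every matching $M$ on $X$ there are pairwise vertex-disjoint paths $P_{uv}$ in $H'$, one for each $\{u,v\}\in M$, with endpoints $u,v$. The linkage capacity $\gamma(H)$ is the supremum of all $c>0$ such that for all sufficiently large $t$, $H\otimes J_t$ contains a matching-linked set of size $\lfloor ct\rfloor$. -}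

module Defs where

open import Data.Nat using (ℕ; _≥_; NonZero)
open import Data.Fin using (Fin)
open import Data.Integer using (ℤ; +_)
open import Data.Rational using (ℚ; _/_; _*_; _<_; floor)
open import Data.Product using (_×_; Σ; ∃; ∃-syntax; _,_; proj₁; proj₂)
open import Data.Sum using (_⊎_)
open import Data.List using (List; []; _∷_; length; concat; map)
open import Data.List.Membership.Propositional using (_∈_)
open import Data.List.Relation.Unary.All using (All)
open import Data.List.Relation.Unary.Unique.Propositional using (Unique)
open import Data.List.Relation.Binary.Pointwise using (Pointwise)
open import Relation.Binary.PropositionalEquality using (_≡_; _≢_)
open import Relation.Nullary using (¬_)

record Graph : Set₁ where
  field
    n     : ℕ
    Adj   : Fin n → Fin n → Set
    sym   : ∀ {u v} → Adj u v → Adj v u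
    irrefl : ∀ {u} → ¬ Adj u u
open Graph public

record GraphOn (V : Set) : Set₁ where
  field
    E : V → V → Set
open GraphOn public

BV : Graph → ℕ → Set
BV H t = Fin (n H) × Fin t

blowup : (H : Graph) (t : ℕ) → GraphOn (BV H t)
blowup H t = record { E = λ x y →
  Adj H (proj₁ x) (proj₁ y) ⊎ (proj₁ x ≡ proj₁ y × proj₂ x ≢ proj₂ y) }

data Walk {V : Set} (R : V → V → Set) : V → V → List V → Set where
  here : ∀ x → Walk R x x (x ∷ [])
  step : ∀ {x y z vs} → R x y → Walk R y z vs → Walk R x z (x ∷ vs)

IsPath : {V : Set} → GraphOn V → V → V → List V → Set
IsPath G u v vs = Walk (E G) u v vs × Unique vs

ends : {V : Set} → List (V × V) → List V
ends [] = []
ends ((u , v) ∷ M) = u ∷ v ∷ ends M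

IsMatchingOn : {V : Set} → List V → List (V × V) → Set
IsMatchingOn X M =
  All (λ p → proj₁ p ≢ proj₂ p × proj₁ p ∈ X × proj₂ p ∈ X) M × Unique (ends M)

MatchingLinked : {V : Set} → GraphOn V → List V → Set
MatchingLinked G X = (M : List (_ × _)) → IsMatchingOn X M →
  ∃[ Ps ] (Pointwise (λ p vs → IsPath G (proj₁ p) (proj₂ p) vs) M Ps
           × Unique (concat Ps))

Admissible : Graph → ℚ → Set
Admissible H c = ∃[ T ] ∀ t → t ≥ T →
  ∃[ X ] (Unique X × MatchingLinked (blowup H t) X
          × + length X ≡ floor (c * (+ t / 1)))

-- γ(H) ≥ r  (γ(H) = sup of admissible c > 0), stated as: every c with
-- 0 < c < r is exceeded by some admissible c' > c.
γ≥ : Graph → ℚ → Set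
γ≥ H r = ∀ c → (+ 0 / 1) < c → c < r → ∃[ c' ] (c < c' × Admissible H c')

-- If 3aq ≤ t, then H ⊗ J_t contains 3a vertex-disjoint copies ("layers") of H ⊗ J_q such that
-- the copies of one vertex in different layers are pairwise adjacent. Put a copy of X into each
-- of the first a layers; this gives a|X| vertices. Given a matching on them, pairs whose two
-- endpoints lie over the same vertex of X are joined by an edge. The other pairs are split
-- greedily into classes whose endpoints lie over pairwise distinct vertices of X. A new class is
-- opened only when the pair clashes with every existing class, and only 2a - 2 other endpoints
-- can lie over the two vertices of the pair, so at most 2a - 1 classes arise. Each class
-- projects to a matching on X, so it can be linked inside its own layer among the remaining 2a
-- ones; its endpoints enter and leave that layer along the cliques. Taking a = ⌊t/3q⌋ gives
-- |X| ⌊t/3q⌋ ≥ ⌊c′ t⌋ for all large t, for every c′ < |X|/3q.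
module Submission where

open import Defs hiding (sym)
open import Data.Empty using (⊥-elim)
open import Data.Fin as Fin using (Fin; combine; inject≤; _↑ˡ_; _↑ʳ_; splitAt)
import Data.Fin.Properties as Fin
open import Data.Integer using (+_; -[1+_])
import Data.Integer as ℤ
import Data.Integer.Properties as ℤ
open import Data.Integer.DivMod using (div-pos-is-/ℕ)
open import Data.List
  using (List; []; _∷_; _++_; [_]; length; concat; map; filter; foldr; cartesianProduct; tabulate; take)
open import Data.List.Properties
  using (length-++; length-map; length-take; length-tabulate; concat-++; concat-map; map-++; ++-assoc;
         filter-++; filter-some; filter-accept; partition-defn)
open import Data.List.Membership.Propositional using (_∈_; _∉_)
open import Data.List.Membership.Propositional.Properties
  using (∈-∃++; ∈-++⁻; ∈-++⁺ˡ; ∈-++⁺ʳ; ∈-map⁺; ∈-map⁻; ∈-filter⁻; ∈-tabulate⁻; ∈-cartesianProduct⁻)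
open import Data.List.Relation.Binary.Disjoint.Propositional using (Disjoint)
open import Data.List.Relation.Binary.Permutation.Propositional
  using (_↭_; refl; prep; swap; trans; ↭-sym; ↭⇒↭ₛ; ↭ₛ⇒↭; module PermutationReasoning)
open import Data.List.Relation.Binary.Permutation.Propositional.Properties
  using (++⁺; ++⁺ˡ; ++⁺ʳ; shift; shifts; All-resp-↭)
import Data.List.Relation.Binary.Permutation.Setoid.Properties as ↭ₛ
open import Data.List.Relation.Binary.Pointwise as Pointwise using (Pointwise; []; _∷_)
open import Data.List.Relation.Binary.Sublist.Propositional.Properties using (take-⊆; Any-resp-⊆)
open import Data.List.Relation.Binary.Subset.Propositional using (_⊆_)
open import Data.List.Relation.Unary.All as All using (All; []; _∷_)
import Data.List.Relation.Unary.All.Properties as All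
open import Data.List.Relation.Unary.Any using (Any; here; there; any?)
open import Data.List.Relation.Unary.Unique.Propositional using (Unique; []; _∷_)
import Data.List.Relation.Unary.Unique.Propositional.Properties as Unique
open import Data.Nat using (ℕ; suc; _+_; _*_; _≤_; _<_; z≤n; s≤s; NonZero)
open import Data.Nat.Coprimality using (Coprime)
open import Data.Nat.DivMod
  using (_/_; m/n*n≤m; m*n/n≡m; m*n/o*n≡m/o; /-congˡ; /-congʳ; /-monoˡ-≤; m≡m%n+[m/n]*n; m%n<n)
import Data.Nat.Properties as ℕ
open import Data.Nat.Tactic.RingSolver using (solve-∀)
open import Data.Product using (_×_; ∃-syntax; _,_; proj₁; proj₂)
import Data.Product as Product
open import Data.Product.Properties using (≡-dec)
open import Data.Rational as ℚ using (ℚ; mkℚ; floor)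
import Data.Rational.Properties as ℚ
open import Data.Rational.Unnormalised as ℚᵘ using (mkℚᵘ; *≡*)
import Data.Rational.Unnormalised.Properties as ℚᵘ
open import Data.Sum using (_⊎_; inj₁; inj₂)
open import Function using (_∘_)
import Relation.Binary.PropositionalEquality as ≡
open import Relation.Binary.PropositionalEquality
  using (_≡_; _≢_; refl; sym; cong; cong₂; subst; subst₂; setoid; module ≡-Reasoning)
open import Relation.Binary.Definitions using (DecidableEquality)
open import Relation.Nullary using (¬_; yes; no)
open import Relation.Nullary.Decidable using (_⊎-dec_)
open import Relation.Unary using (Decidable)
open import Relation.Unary.Properties using (∁?)

private variable
  A B W : Set

Unique-resp-↭ : {xs ys : List A} → xs ↭ ys → Unique xs → Unique ys
Unique-resp-↭ {A = A} xs↭ys = ↭ₛ.Unique-resp-↭ (setoid A) (↭⇒↭ₛ xs↭ys)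

Unique-++⁻ : (xs : List A) {ys : List A} → Unique (xs ++ ys) → Unique xs × Unique ys
Unique-++⁻ []       u        = [] , u
Unique-++⁻ (x ∷ xs) (x∉ ∷ u) with Unique-++⁻ xs u
... | uxs , uys = All.++⁻ˡ xs x∉ ∷ uxs , uys

Unique∧⊆⇒length≤ : {xs ys : List A} → Unique xs → xs ⊆ ys → length xs ≤ length ys
Unique∧⊆⇒length≤ []                          _     = z≤n
Unique∧⊆⇒length≤ {xs = x ∷ xs} (x∉ ∷ u) xs⊆ys with ∈-∃++ (xs⊆ys (here refl))
... | ys₁ , ys₂ , refl = begin
  suc (length xs)               ≤⟨ s≤s (Unique∧⊆⇒length≤ u xs⊆ys₁++ys₂) ⟩
  suc (length (ys₁ ++ ys₂))     ≡⟨ cong suc (length-++ ys₁) ⟩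
  suc (length ys₁ + length ys₂) ≡⟨ ℕ.+-suc (length ys₁) _ ⟨
  length ys₁ + length (x ∷ ys₂) ≡⟨ length-++ ys₁ ⟨
  length (ys₁ ++ x ∷ ys₂)       ∎
  where
  open ℕ.≤-Reasoning
  xs⊆ys₁++ys₂ : xs ⊆ ys₁ ++ ys₂
  xs⊆ys₁++ys₂ z∈xs with ∈-++⁻ ys₁ (xs⊆ys (there z∈xs))
  ... | inj₁ z∈ys₁         = ∈-++⁺ˡ z∈ys₁
  ... | inj₂ (here refl)   = ⊥-elim (All.lookup x∉ z∈xs refl)
  ... | inj₂ (there z∈ys₂) = ∈-++⁺ʳ ys₁ z∈ys₂

concat-↭ : {xss yss : List (List A)} → xss ↭ yss → concat xss ↭ concat yss
concat-↭ refl                      = refl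
concat-↭ (prep xs ρ)               = ++⁺ˡ xs (concat-↭ ρ)
concat-↭ (swap {xs = xss} xs ys ρ) = trans (shifts xs ys {concat xss}) (++⁺ˡ ys (++⁺ˡ xs (concat-↭ ρ)))
concat-↭ (trans ρ₁ ρ₂)             = trans (concat-↭ ρ₁) (concat-↭ ρ₂)

Pointwise-resp-↭ : {R : A → B → Set} {xs ys : List A} {zs : List B} → xs ↭ ys →
  Pointwise R ys zs → ∃[ ws ] (Pointwise R xs ws × ws ↭ zs)
Pointwise-resp-↭ refl rs = _ , rs , refl
Pointwise-resp-↭ (prep x ρ) (r ∷ rs) with Pointwise-resp-↭ ρ rs
... | ws , rs′ , σ = _ ∷ ws , r ∷ rs′ , prep _ σ
Pointwise-resp-↭ (swap x y ρ) (r ∷ r′ ∷ rs) with Pointwise-resp-↭ ρ rs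
... | ws , rs′ , σ = _ ∷ _ ∷ ws , r′ ∷ r ∷ rs′ , swap _ _ σ
Pointwise-resp-↭ (trans ρ₁ ρ₂) rs with Pointwise-resp-↭ ρ₂ rs
... | ws₂ , rs₂ , σ₂ with Pointwise-resp-↭ ρ₁ rs₂
... | ws₁ , rs₁ , σ₁ = ws₁ , rs₁ , trans σ₁ σ₂

↭-filter-∁ : {P : A → Set} (P? : Decidable P) (xs : List A) → xs ↭ filter P? xs ++ filter (∁? P?) xs
↭-filter-∁ {A = A} P? xs =
  subst (λ (ys , zs) → xs ↭ ys ++ zs) (partition-defn P? xs) (↭ₛ⇒↭ (↭ₛ.partition-↭ (setoid A) P? xs))

length-cartesianProduct : (xs : List A) (ys : List B) → length (cartesianProduct xs ys) ≡ length xs * length ys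
length-cartesianProduct []       ys = refl
length-cartesianProduct (x ∷ xs) ys = begin
  length (map (x ,_) ys ++ cartesianProduct xs ys)         ≡⟨ length-++ (map (x ,_) ys) ⟩
  length (map (x ,_) ys) + length (cartesianProduct xs ys) ≡⟨ cong₂ _+_ (length-map (x ,_) ys)
                                                                         (length-cartesianProduct xs ys) ⟩
  length ys + length xs * length ys                        ∎
  where open ≡-Reasoning

ends-++ : (M N : List (A × A)) → ends (M ++ N) ≡ ends M ++ ends N
ends-++ []            N = refl
ends-++ ((u , v) ∷ M) N = cong (λ vs → u ∷ v ∷ vs) (ends-++ M N)

ends-map : (f : A → B) (M : List (A × A)) → ends (map (Product.map f f) M) ≡ map f (ends M)
ends-map f []            = refl
ends-map f ((u , v) ∷ M) = cong (λ vs → f u ∷ f v ∷ vs) (ends-map f M)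

ends-↭ : {M N : List (A × A)} → M ↭ N → ends M ↭ ends N
ends-↭ refl                                = refl
ends-↭ (prep (u , v) ρ)                    = prep u (prep v (ends-↭ ρ))
ends-↭ (swap {xs = M} (u , v) (u′ , v′) ρ) =
  trans (shifts (u ∷ v ∷ []) (u′ ∷ v′ ∷ []) {ends M}) (++⁺ˡ (u′ ∷ v′ ∷ u ∷ v ∷ []) (ends-↭ ρ))
ends-↭ (trans ρ₁ ρ₂)                       = trans (ends-↭ ρ₁) (ends-↭ ρ₂)

All-ends : {P : A → Set} {M : List (A × A)} → All (λ p → P (proj₁ p) × P (proj₂ p)) M → All P (ends M)
All-ends []               = []
All-ends ((Pu , Pv) ∷ PM) = Pu ∷ Pv ∷ All-ends PM

-- Walks and linkages

walk-map : {R : A → A → Set} {R′ : B → B → Set} (f : A → B) → (∀ {x y} → R x y → R′ (f x) (f y)) →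
  ∀ {x y vs} → Walk R x y vs → Walk R′ (f x) (f y) (map f vs)
walk-map f hom (here x)   = here (f x)
walk-map f hom (step r w) = step (hom r) (walk-map f hom w)

walk-snoc : {R : A → A → Set} {x y z : A} {vs : List A} → Walk R x y vs → R y z → Walk R x z (vs ++ [ z ])
walk-snoc (here x)    r = step r (here _)
walk-snoc (step r′ w) r = step r′ (walk-snoc w r)

Walks : GraphOn W → List (W × W) → List (List W) → Set
Walks G = Pointwise (λ p vs → Walk (E G) (proj₁ p) (proj₂ p) vs)

Linking : GraphOn W → List (W × W) → List (List W) → Set
Linking G = Pointwise (λ p vs → IsPath G (proj₁ p) (proj₂ p) vs)

walks⇒linking : {G : GraphOn W} {M : List (W × W)} {Ps : List (List W)} →
  Walks G M Ps → Unique (concat Ps) → Linking G M Ps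
walks⇒linking []                     _ = []
walks⇒linking {Ps = vs ∷ _} (w ∷ ws) u with Unique-++⁻ vs u
... | uvs , uPs = (w , uvs) ∷ walks⇒linking ws uPs

linking⇒walks : {G : GraphOn W} {M : List (W × W)} {Ps : List (List W)} → Linking G M Ps → Walks G M Ps
linking⇒walks = Pointwise.map proj₁

record Linkage (G : GraphOn W) (M : List (W × W)) (I : List W) : Set where
  field
    paths    : List (List W)
    walks    : Walks G M paths
    vertices : concat paths ↭ ends M ++ I
open Linkage

linkage-++ : {G : GraphOn W} {M N : List (W × W)} {I J : List W} →
  Linkage G M I → Linkage G N J → Linkage G (M ++ N) (I ++ J)
linkage-++ {M = M} {N} {I} {J} ℒ ℒ′ = record
  { paths    = paths ℒ ++ paths ℒ′
  ; walks    = Pointwise.++⁺ (walks ℒ) (walks ℒ′)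
  ; vertices = begin
      concat (paths ℒ ++ paths ℒ′)          ≡⟨ concat-++ (paths ℒ) (paths ℒ′) ⟨
      concat (paths ℒ) ++ concat (paths ℒ′) ↭⟨ ++⁺ (vertices ℒ) (vertices ℒ′) ⟩
      (ends M ++ I) ++ (ends N ++ J)        ≡⟨ ++-assoc (ends M) I _ ⟩
      ends M ++ (I ++ (ends N ++ J))        ↭⟨ ++⁺ˡ (ends M) (shifts I (ends N)) ⟩
      ends M ++ (ends N ++ (I ++ J))        ≡⟨ ++-assoc (ends M) (ends N) _ ⟨
      (ends M ++ ends N) ++ (I ++ J)        ≡⟨ cong (_++ (I ++ J)) (ends-++ M N) ⟨
      ends (M ++ N) ++ (I ++ J)             ∎
  }
  where open PermutationReasoning

linkage-↭ : {G : GraphOn W} {M N : List (W × W)} {I : List W} → M ↭ N → Linkage G N I → Linkage G M I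
linkage-↭ {M = M} {N} {I} M↭N ℒ with Pointwise-resp-↭ M↭N (walks ℒ)
... | Ps , ws , Ps↭ = record
  { paths    = Ps
  ; walks    = ws
  ; vertices = begin
      concat Ps          ↭⟨ concat-↭ Ps↭ ⟩
      concat (paths ℒ)   ↭⟨ vertices ℒ ⟩
      ends N ++ I        ↭⟨ ++⁺ʳ I (ends-↭ M↭N) ⟨
      ends M ++ I        ∎
  }
  where open PermutationReasoning

linkage⇒linking : {G : GraphOn W} {M : List (W × W)} {I : List W} →
  Linkage G M I → Unique (ends M ++ I) → ∃[ Ps ] (Linking G M Ps × Unique (concat Ps))
linkage⇒linking ℒ u = paths ℒ , walks⇒linking (walks ℒ) uPs , uPs
  where uPs = Unique-resp-↭ (↭-sym (vertices ℒ)) u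

MatchingLinked-⊆ : {G : GraphOn W} {X Y : List W} → Y ⊆ X → MatchingLinked G X → MatchingLinked G Y
MatchingLinked-⊆ Y⊆X linked M (pairs , u) =
  linked M (All.map (λ (u≢v , u∈Y , v∈Y) → u≢v , Y⊆X u∈Y , Y⊆X v∈Y) pairs , u)

module _ {V : Set} {G : GraphOn V} {G′ : GraphOn W} (f : V → W)
         (f-injective : ∀ {u v} → f u ≡ f v → u ≡ v)
         (f-homomorphism : ∀ {u v} → E G u v → E G′ (f u) (f v)) where

  private
    MatchedIn : List A → A × A → Set
    MatchedIn X p = proj₁ p ≢ proj₂ p × proj₁ p ∈ X × proj₂ p ∈ X

    pullback : ∀ {X} M′ → All (MatchedIn (map f X)) M′ →
      ∃[ M ] (map (Product.map f f) M ≡ M′ × All (MatchedIn X) M)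
    pullback []       []                      = [] , refl , []
    pullback (_ ∷ M′) ((u≢v , u∈ , v∈) ∷ ok) with ∈-map⁻ f u∈ | ∈-map⁻ f v∈ | pullback M′ ok
    ... | x , x∈X , refl | y , y∈X , refl | M , refl , okM =
      (x , y) ∷ M , refl , ((λ x≡y → u≢v (cong f x≡y)) , x∈X , y∈X) ∷ okM

  MatchingLinked-map : ∀ {X} → MatchingLinked G X → MatchingLinked G′ (map f X)
  MatchingLinked-map linked M′ (ok , u) with pullback M′ ok
  ... | M , refl , okM with linked M (okM , Unique.map⁻ (subst Unique (ends-map f M) u))
  ... | Ps , links , uPs = map (map f) Ps , walks⇒linking fwalks ufPs , ufPs
    where
    fwalks : Walks G′ (map (Product.map f f) M) (map (map f) Ps)
    fwalks = Pointwise.map⁺ _ (map f) (Pointwise.map (walk-map f f-homomorphism ∘ proj₁) links)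
    ufPs : Unique (concat (map (map f) Ps))
    ufPs = subst Unique (sym (concat-map Ps)) (Unique.map⁺ f-injective uPs)

-- Splitting a matching into classes over distinct base vertices

module _ {V Λ : Set} where

  Vertical : (V × Λ) × (V × Λ) → Set
  Vertical ((x , _) , (y , _)) = x ≡ y

  BaseDisjoint : List ((V × Λ) × (V × Λ)) → Set
  BaseDisjoint C = Unique (map proj₁ (ends C))

module Classification {V Λ : Set} (_≟_ : DecidableEquality V) where

  Pair : Set
  Pair = (V × Λ) × (V × Λ)

  vertical? : Decidable (Vertical {V} {Λ})
  vertical? ((x , _) , (y , _)) = x ≟ y

  Touches : Pair → V × Λ → Set
  Touches ((x , _) , (y , _)) (z , _) = z ≡ x ⊎ z ≡ y

  touches? : ∀ p → Decidable (Touches p)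
  touches? ((x , _) , (y , _)) (z , _) = (z ≟ x) ⊎-dec (z ≟ y)

  Conflict : Pair → List Pair → Set
  Conflict p C = Any (Touches p) (ends C)

  insert : Pair → List (List Pair) → List (List Pair)
  insert p []       = [ [ p ] ]
  insert p (C ∷ Cs) with any? (touches? p) (ends C)
  ... | yes _ = C ∷ insert p Cs
  ... | no  _ = (p ∷ C) ∷ Cs

  classify : List Pair → List (List Pair)
  classify = foldr insert []

  insert-↭ : ∀ p Cs → concat (insert p Cs) ↭ p ∷ concat Cs
  insert-↭ p []       = refl
  insert-↭ p (C ∷ Cs) with any? (touches? p) (ends C)
  ... | yes _ = trans (++⁺ˡ C (insert-↭ p Cs)) (shift p C (concat Cs))
  ... | no  _ = refl

  classify-↭ : ∀ N → concat (classify N) ↭ N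
  classify-↭ []      = refl
  classify-↭ (p ∷ N) = trans (insert-↭ p (classify N)) (prep p (classify-↭ N))

  insert-baseDisjoint : ∀ p Cs → ¬ Vertical p → All BaseDisjoint Cs → All BaseDisjoint (insert p Cs)
  insert-baseDisjoint p []       x≢y []         = ((x≢y ∷ []) ∷ [] ∷ []) ∷ []
  insert-baseDisjoint p (C ∷ Cs) x≢y (bd ∷ bds) with any? (touches? p) (ends C)
  ... | yes _        = bd ∷ insert-baseDisjoint p Cs x≢y bds
  ... | no ¬conflict = ((x≢y ∷ avoid inj₁) ∷ avoid inj₂ ∷ bd) ∷ bds
    where
    avoid : ∀ {w} → (∀ {v} → proj₁ v ≡ w → Touches p v) → All (w ≢_) (map proj₁ (ends C))
    avoid touch = All.map⁺ (All.map (λ {v} ¬t w≡z → ¬t (touch {v} (sym w≡z))) (All.¬Any⇒All¬ (ends C) ¬conflict))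

  classify-baseDisjoint : ∀ N → All (¬_ ∘ Vertical) N → All BaseDisjoint (classify N)
  classify-baseDisjoint []      []         = []
  classify-baseDisjoint (p ∷ N) (x≢y ∷ ns) = insert-baseDisjoint p (classify N) x≢y (classify-baseDisjoint N ns)

  length-insert : ∀ p Cs → length (insert p Cs) ≡ length Cs
                         ⊎ (length (insert p Cs) ≡ suc (length Cs) × All (Conflict p) Cs)
  length-insert p []       = inj₂ (refl , [])
  length-insert p (C ∷ Cs) with any? (touches? p) (ends C)
  ... | no _  = inj₁ refl
  ... | yes c with length-insert p Cs
  ...   | inj₁ same               = inj₁ (cong suc same)
  ...   | inj₂ (grew , conflicts) = inj₂ (cong suc grew , c ∷ conflicts)

  module Counting (S : List Λ) where

    InLayers : V × Λ → Set
    InLayers v = proj₂ v ∈ S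

    touching-⊆ : ∀ p {vs} → All InLayers vs →
      filter (touches? p) vs ⊆ map (proj₁ (proj₁ p) ,_) S ++ map (proj₁ (proj₂ p) ,_) S
    touching-⊆ p inS {z , i} v∈ with ∈-filter⁻ (touches? p) v∈
    ... | v∈vs , inj₁ refl = ∈-++⁺ˡ (∈-map⁺ _ (All.lookup inS v∈vs))
    ... | v∈vs , inj₂ refl = ∈-++⁺ʳ _ (∈-map⁺ _ (All.lookup inS v∈vs))

    conflicts≤touching : ∀ p Cs → All (Conflict p) Cs → length Cs ≤ length (filter (touches? p) (ends (concat Cs)))
    conflicts≤touching p []       []       = z≤n
    conflicts≤touching p (C ∷ Cs) (c ∷ cs) = begin
      1 + length Cs                                                      ≤⟨ ℕ.+-mono-≤ (filter-some (touches? p) c)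
                                                                                       (conflicts≤touching p Cs cs) ⟩
      length (touching (ends C)) + length (touching (ends (concat Cs))) ≡⟨ length-++ (touching (ends C)) ⟨
      length (touching (ends C) ++ touching (ends (concat Cs)))          ≡⟨ cong length (filter-++ (touches? p) (ends C) _) ⟨
      length (touching (ends C ++ ends (concat Cs)))                     ≡⟨ cong (length ∘ touching) (ends-++ C (concat Cs)) ⟨
      length (touching (ends (C ++ concat Cs)))                          ∎
      where
      open ℕ.≤-Reasoning
      touching = filter (touches? p)

    2+|conflicts|≤2|S| : ∀ p Cs → All (Conflict p) Cs → Unique (ends (p ∷ concat Cs)) →
      All InLayers (ends (p ∷ concat Cs)) → 2 + length Cs ≤ 2 * length S
    2+|conflicts|≤2|S| p Cs cs u inS = begin
      2 + length Cs                                 ≤⟨ s≤s (s≤s (conflicts≤touching p Cs cs)) ⟩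
      2 + length (touching (ends (concat Cs)))      ≡⟨ cong length touching-p ⟨
      length (touching (ends (p ∷ concat Cs)))      ≤⟨ Unique∧⊆⇒length≤ (Unique.filter⁺ (touches? p) u) (touching-⊆ p inS) ⟩
      length (map (x ,_) S ++ map (y ,_) S)         ≡⟨ length-++ (map (x ,_) S) ⟩
      length (map (x ,_) S) + length (map (y ,_) S) ≡⟨ cong₂ _+_ (length-map _ S) (length-map _ S) ⟩
      length S + length S                           ≡⟨ cong (λ n → length S + n) (ℕ.+-identityʳ (length S)) ⟨
      2 * length S                                  ∎
      where
      open ℕ.≤-Reasoning
      x = proj₁ (proj₁ p)
      y = proj₁ (proj₂ p)
      touching = filter (touches? p)
      touching-p : touching (ends (p ∷ concat Cs)) ≡ proj₁ p ∷ proj₂ p ∷ touching (ends (concat Cs))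
      touching-p = ≡.trans (filter-accept (touches? p) (inj₁ refl))
                           (cong (proj₁ p ∷_) (filter-accept (touches? p) (inj₂ refl)))

    length-classify : ∀ {k} N → 2 * length S ≤ suc k → Unique (ends N) → All InLayers (ends N) →
      length (classify N) ≤ k
    length-classify         []      _   _                  _                    = z≤n
    length-classify {k} (p ∷ N) few u@(_ ∷ _ ∷ uN) inS@(_ ∷ _ ∷ inSN) with length-insert p (classify N)
    ... | inj₁ same               = subst (_≤ k) (sym same) (length-classify N few uN inSN)
    ... | inj₂ (grew , conflicts) =
      subst (_≤ k) (sym grew) (ℕ.≤-pred (ℕ.≤-trans (2+|conflicts|≤2|S| p (classify N) conflicts u′ inS′) few))
      where
      ends↭ : ends (p ∷ N) ↭ ends (p ∷ concat (classify N))
      ends↭ = ends-↭ (prep p (↭-sym (classify-↭ N)))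
      u′ = Unique-resp-↭ ends↭ u
      inS′ = All-resp-↭ ends↭ inS

-- Routing in layers

_□K_ : {V : Set} → GraphOn V → (Λ : Set) → GraphOn (V × Λ)
G □K Λ = record { E = λ u v → (proj₂ u ≡ proj₂ v × E G (proj₁ u) (proj₁ v))
                             ⊎ (proj₁ u ≡ proj₁ v × proj₂ u ≢ proj₂ v) }

module Routing {V Λ : Set} (G : GraphOn V) {X : List V} (linked : MatchingLinked G X) (S : List Λ) where

  InGrid : V × Λ → Set
  InGrid (x , i) = x ∈ X × i ∈ S

  atLayer : Λ → List V → List (V × Λ)
  atLayer L = map (_, L)

  base² : (V × Λ) × (V × Λ) → V × V
  base² = Product.map proj₁ proj₁

  vertical-linkage : ∀ {Ls} → All (λ p → Vertical p × proj₁ p ≢ proj₂ p) Ls → Linkage (G □K Λ) Ls []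
  vertical-linkage []                                 = record { paths = [] ; walks = [] ; vertices = refl }
  vertical-linkage {(u , v) ∷ _} ((x≡y , u≢v) ∷ vs) = record
    { paths    = (u ∷ v ∷ []) ∷ paths rest
    ; walks    = step (inj₂ (x≡y , λ i≡j → u≢v (cong₂ _,_ x≡y i≡j))) (here v) ∷ walks rest
    ; vertices = prep u (prep v (vertices rest))
    }
    where rest = vertical-linkage vs

  class-linkage : ∀ L → L ∉ S → ∀ {C Qs} → All (λ v → proj₂ v ∈ S) (ends C) →
    Walks G (map base² C) Qs → Linkage (G □K Λ) C (atLayer L (concat Qs))
  class-linkage L L∉S {[]}          {[]}     []                  []       =
    record { paths = [] ; walks = [] ; vertices = refl }
  class-linkage L L∉S {(u , v) ∷ C} {Q ∷ Qs} (i∈S ∷ j∈S ∷ inS) (w ∷ ws) = record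
    { paths    = (u ∷ atLayer L Q ++ [ v ]) ∷ paths rest
    ; walks    = step (inj₂ (refl , off i∈S))
                      (walk-snoc (walk-map (_, L) (λ e → inj₁ (refl , e)) w) (inj₂ (refl , off j∈S ∘ sym)))
                 ∷ walks rest
    ; vertices = begin
        u ∷ (atLayer L Q ++ [ v ]) ++ concat (paths rest)      ≡⟨ cong (u ∷_) (++-assoc (atLayer L Q) [ v ] _) ⟩
        u ∷ atLayer L Q ++ v ∷ concat (paths rest)             ↭⟨ prep u (shift v (atLayer L Q) _) ⟩
        u ∷ v ∷ atLayer L Q ++ concat (paths rest)             ↭⟨ prep u (prep v (++⁺ˡ (atLayer L Q) (vertices rest))) ⟩
        u ∷ v ∷ atLayer L Q ++ ends C ++ atLayer L (concat Qs) ↭⟨ prep u (prep v (shifts (atLayer L Q) (ends C))) ⟩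
        u ∷ v ∷ ends C ++ atLayer L Q ++ atLayer L (concat Qs) ≡⟨ cong (λ vs → u ∷ v ∷ ends C ++ vs) (map-++ (_, L) Q (concat Qs)) ⟨
        u ∷ v ∷ ends C ++ atLayer L (Q ++ concat Qs)           ∎
    }
    where
    open PermutationReasoning
    rest = class-linkage L L∉S inS ws
    off : ∀ {i} → i ∈ S → i ≢ L
    off i∈S refl = L∉S i∈S

  class-matching : ∀ {C} → BaseDisjoint C → All InGrid (ends C) → IsMatchingOn X (map base² C)
  class-matching {C} bd inG = distinct-in-X bd inG , subst Unique (sym (ends-map proj₁ C)) bd
    where
    distinct-in-X : ∀ {C} → BaseDisjoint C → All InGrid (ends C) →
      All (λ p → proj₁ p ≢ proj₂ p × proj₁ p ∈ X × proj₂ p ∈ X) (map base² C)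
    distinct-in-X {[]}    _                    []                              = []
    distinct-in-X {_ ∷ _} ((x≢y ∷ _) ∷ _ ∷ bd) ((x∈X , _) ∷ (y∈X , _) ∷ inG) =
      (x≢y , x∈X , y∈X) ∷ distinct-in-X bd inG

  route-class : ∀ L → L ∉ S → ∀ {C} → BaseDisjoint C → All InGrid (ends C) →
    ∃[ Q ] (Unique Q × Linkage (G □K Λ) C (atLayer L Q))
  route-class L L∉S {C} bd inG with linked (map base² C) (class-matching bd inG)
  ... | Qs , links , uQs = concat Qs , uQs , class-linkage L L∉S (All.map proj₂ inG) (linking⇒walks links)

  route-classes : ∀ Cs R → length Cs ≤ length R → Unique R → Disjoint S R → All BaseDisjoint Cs →
    All InGrid (ends (concat Cs)) →
    ∃[ I ] (Unique I × All (λ v → proj₂ v ∈ R) I × Linkage (G □K Λ) (concat Cs) I)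
  route-classes []       R       _         _          _   []         [] =
    [] , [] , [] , record { paths = [] ; walks = [] ; vertices = refl }
  route-classes (C ∷ Cs) (L ∷ R) (s≤s len) (L∉R ∷ uR) S#R (bd ∷ bds) inG
    with All.++⁻ (ends C) (subst (All InGrid) (ends-++ C (concat Cs)) inG)
  ... | inC , inCs
    with route-class L (λ L∈S → S#R (L∈S , here refl)) bd inC
       | route-classes Cs R len uR (λ (i∈S , i∈R) → S#R (i∈S , there i∈R)) bds inCs
  ... | Q , uQ , ℒ | I , uI , I∈R , ℒ′ =
    atLayer L Q ++ I ,
    Unique.++⁺ (Unique.map⁺ (cong proj₁) uQ) uI separated ,
    All.++⁺ (All.map⁺ (All.tabulate (λ _ → here refl))) (All.map there I∈R) ,
    linkage-++ ℒ ℒ′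
    where
    separated : Disjoint (atLayer L Q) I
    separated (v∈LQ , v∈I) with ∈-map⁻ (_, L) v∈LQ
    ... | _ , _ , refl = All.lookup L∉R (All.lookup I∈R v∈I) refl

□K-matchingLinked : {V Λ : Set} → DecidableEquality V → {G : GraphOn V} {X : List V} → MatchingLinked G X →
  {S R : List Λ} → Unique R → Disjoint S R → 2 * length S ≤ suc (length R) →
  MatchingLinked (G □K Λ) (cartesianProduct X S)
□K-matchingLinked _≟_ {G} {X} linked {S} {R} uR S#R few M (pairs , u) =
  let I , uI , I∈R , ℒ = route-classes Cs R |Cs|≤|R| uR S#R classes-baseDisjoint classes-inGrid
  in linkage⇒linking (linkage-↭ M↭ (linkage-++ (vertical-linkage verticals) ℒ))
       (Unique.++⁺ u uI (λ (v∈M , v∈I) → S#R (proj₂ (All.lookup inGrid v∈M) , All.lookup I∈R v∈I)))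
  where
  open Classification _≟_
  open Counting S
  open Routing G linked S
  Ls = filter vertical? M
  N  = filter (∁? vertical?) M
  Cs = classify N

  M↭ : M ↭ Ls ++ concat Cs
  M↭ = trans (↭-filter-∁ vertical? M) (++⁺ˡ Ls (↭-sym (classify-↭ N)))

  inGrid : All InGrid (ends M)
  inGrid = All-ends (All.map (λ (_ , u∈ , v∈) → ∈-cartesianProduct⁻ X S u∈ , ∈-cartesianProduct⁻ X S v∈) pairs)

  ends-split : ends M ↭ ends Ls ++ ends N
  ends-split = subst (ends M ↭_) (ends-++ Ls N) (ends-↭ (↭-filter-∁ vertical? M))

  N-inGrid : All InGrid (ends N)
  N-inGrid = All.++⁻ʳ (ends Ls) (All-resp-↭ ends-split inGrid)

  |Cs|≤|R| : length Cs ≤ length R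
  |Cs|≤|R| = length-classify N few (proj₂ (Unique-++⁻ (ends Ls) (Unique-resp-↭ ends-split u))) (All.map proj₂ N-inGrid)

  classes-baseDisjoint : All BaseDisjoint Cs
  classes-baseDisjoint = classify-baseDisjoint N (All.all-filter (∁? vertical?) M)

  classes-inGrid : All InGrid (ends (concat Cs))
  classes-inGrid = All-resp-↭ (ends-↭ (↭-sym (classify-↭ N))) N-inGrid

  verticals : All (λ p → Vertical p × proj₁ p ≢ proj₂ p) Ls
  verticals = All.zip (All.all-filter vertical? M , All.filter⁺ vertical? (All.map proj₁ pairs))

-- Layers inside a larger blowup

module _ (H : Graph) {q s t : ℕ} (sq≤t : s * q ≤ t) where

  embedLayers : BV H q × Fin s → BV H t
  embedLayers ((v , k) , ℓ) = v , inject≤ (combine ℓ k) sq≤t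

  private
    inject-combine-injective : ∀ {ℓ ℓ′ : Fin s} {k k′ : Fin q} →
      inject≤ (combine ℓ k) sq≤t ≡ inject≤ (combine ℓ′ k′) sq≤t → ℓ ≡ ℓ′ × k ≡ k′
    inject-combine-injective {ℓ} {ℓ′} {k} {k′} e =
      Fin.combine-injective ℓ k ℓ′ k′ (Fin.inject≤-injective sq≤t sq≤t _ _ e)

  embedLayers-injective : ∀ {x y} → embedLayers x ≡ embedLayers y → x ≡ y
  embedLayers-injective e with cong proj₁ e | inject-combine-injective (cong proj₂ e)
  ... | refl | refl , refl = refl

  embedLayers-homomorphism : ∀ {x y} → E (blowup H q □K Fin s) x y → E (blowup H t) (embedLayers x) (embedLayers y)
  embedLayers-homomorphism (inj₁ (_ , inj₁ adj))             = inj₁ adj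
  embedLayers-homomorphism (inj₁ (refl , inj₂ (v≡v′ , k≢k′))) =
    inj₂ (v≡v′ , k≢k′ ∘ proj₂ ∘ inject-combine-injective)
  embedLayers-homomorphism (inj₂ (vk≡vk′ , ℓ≢ℓ′))            =
    inj₂ (cong proj₁ vk≡vk′ , ℓ≢ℓ′ ∘ proj₁ ∘ inject-combine-injective)

lowerLayers : ∀ a → List (Fin (3 * a))
lowerLayers a = tabulate {n = a} (_↑ˡ (2 * a))

upperLayers : ∀ a → List (Fin (3 * a))
upperLayers a = tabulate {n = 2 * a} (a ↑ʳ_)

lowerLayers#upperLayers : ∀ a → Disjoint (lowerLayers a) (upperLayers a)
lowerLayers#upperLayers a (ℓ∈lower , ℓ∈upper)
  with ∈-tabulate⁻ {n = a} {f = _↑ˡ (2 * a)} ℓ∈lower | ∈-tabulate⁻ {n = 2 * a} {f = a ↑ʳ_} ℓ∈upper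
... | i , refl | j , e
  with ≡.trans (sym (Fin.splitAt-↑ˡ a i (2 * a))) (≡.trans (cong (splitAt a) e) (Fin.splitAt-↑ʳ a (2 * a) j))
... | ()

blowup-matchingLinked : (H : Graph) {q : ℕ} {X : List (BV H q)} → Unique X → MatchingLinked (blowup H q) X →
  ∀ {a t} → 3 * a * q ≤ t → ∃[ Y ] (Unique Y × MatchingLinked (blowup H t) Y × length Y ≡ length X * a)
blowup-matchingLinked H {q} {X} uX linked {a} 3aq≤t =
  map embed (cartesianProduct X (lowerLayers a)) ,
  Unique.map⁺ (embedLayers-injective H 3aq≤t)
    (Unique.cartesianProduct⁺ uX (Unique.tabulate⁺ (Fin.↑ˡ-injective (2 * a) _ _))) ,
  MatchingLinked-map embed (embedLayers-injective H 3aq≤t) (embedLayers-homomorphism H 3aq≤t)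
    (□K-matchingLinked (≡-dec Fin._≟_ Fin._≟_) linked (Unique.tabulate⁺ (Fin.↑ʳ-injective a _ _))
                       (lowerLayers#upperLayers a) few) ,
  (begin
    length (map embed (cartesianProduct X (lowerLayers a))) ≡⟨ length-map embed (cartesianProduct X (lowerLayers a)) ⟩
    length (cartesianProduct X (lowerLayers a))             ≡⟨ length-cartesianProduct X (lowerLayers a) ⟩
    length X * length (lowerLayers a)                       ≡⟨ cong (length X *_) |lowerLayers| ⟩
    length X * a                                            ∎)
  where
  open ≡-Reasoning
  embed = embedLayers H 3aq≤t
  |lowerLayers| = length-tabulate {n = a} (_↑ˡ (2 * a))
  few : 2 * length (lowerLayers a) ≤ suc (length (upperLayers a))
  few = subst₂ (λ m n → 2 * m ≤ suc n) (sym |lowerLayers|) (sym (length-tabulate {n = 2 * a} (a ↑ʳ_)))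
          (ℕ.n≤1+n (2 * a))

-- Rational arithmetic

floor-≃ : ∀ p {n d-1} → ℚ.toℚᵘ p ℚᵘ.≃ mkℚᵘ (+ n) d-1 → floor p ≡ + (n / suc d-1)
floor-≃ (mkℚ (+ a) b-1 _) {n} {d-1} (*≡* ad≡nb) = ≡.trans (div-pos-is-/ℕ (+ a) b) (cong +_ (begin
  a / b             ≡⟨ m*n/o*n≡m/o a d b ⟨
  (a * d) / (b * d) ≡⟨ /-congˡ ad≡nb′ ⟩
  (n * b) / (b * d) ≡⟨ /-congʳ {m = n * b} (ℕ.*-comm b d) ⟩
  (n * b) / (d * b) ≡⟨ m*n/o*n≡m/o n b d ⟩
  n / d             ∎))
  where
  open ≡-Reasoning
  b = suc b-1
  d = suc d-1
  ad≡nb′ : a * d ≡ n * b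
  ad≡nb′ = ℤ.+-injective (≡.trans (ℤ.pos-* a d) (≡.trans ad≡nb (sym (ℤ.pos-* n b))))
floor-≃ (mkℚ -[1+ _ ] _ _) {n} (*≡* eq) with ≡.trans eq (sym (ℤ.pos-* n _))
... | ()

floor[P/E*t]≡P*t/E : ∀ P E-1 .(c : Coprime P (suc E-1)) t →
  floor (mkℚ (+ P) E-1 c ℚ.* (+ t ℚ./ 1)) ≡ + (P * t / suc E-1)
floor[P/E*t]≡P*t/E P E-1 c t = floor-≃ (mkℚ (+ P) E-1 c ℚ.* (+ t ℚ./ 1))
  (ℚᵘ.≃-trans (ℚ.toℚᵘ-homo-* (mkℚ (+ P) E-1 c) (+ t ℚ./ 1))
  (ℚᵘ.≃-trans (ℚᵘ.*-congˡ {mkℚᵘ (+ P) E-1} (ℚ.toℚᵘ-fromℚᵘ (mkℚᵘ (+ t) 0)))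
              (ℚᵘ.≃-reflexive (cong₂ mkℚᵘ (sym (ℤ.pos-* P t)) (ℕ.*-identityʳ E-1)))))

P/E<[1/k]*[N/q]⇒P*kq<N*E : ∀ {P E-1 k q N} .{c : Coprime P (suc E-1)} .{{_ : NonZero k}} .{{_ : NonZero q}} →
  mkℚ (+ P) E-1 c ℚ.< (+ 1 ℚ./ k) ℚ.* (+ N ℚ./ q) → P * (k * q) < N * suc E-1
P/E<[1/k]*[N/q]⇒P*kq<N*E {P} {E-1} {suc k-1} {suc q-1} {N} c<r =
  ℤ.drop‿+<+ (subst₂ ℤ._<_ (sym (ℤ.pos-* P _))
                           (≡.trans (cong (ℤ._* + suc E-1) (ℤ.*-identityˡ (+ N))) (sym (ℤ.pos-* N _)))
                           (ℚᵘ.drop-*<* (ℚᵘ.<-respʳ-≃ r≃ (ℚ.toℚᵘ-mono-< c<r))))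
  where
  r≃ : ℚ.toℚᵘ ((+ 1 ℚ./ suc k-1) ℚ.* (+ N ℚ./ suc q-1)) ℚᵘ.≃ mkℚᵘ (+ 1) k-1 ℚᵘ.* mkℚᵘ (+ N) q-1
  r≃ = ℚᵘ.≃-trans (ℚ.toℚᵘ-homo-* (+ 1 ℚ./ suc k-1) (+ N ℚ./ suc q-1))
         (ℚᵘ.*-cong (ℚ.toℚᵘ-fromℚᵘ (mkℚᵘ (+ 1) k-1)) (ℚ.toℚᵘ-fromℚᵘ (mkℚᵘ (+ N) q-1)))

P*t/E≤N*[t/D] : ∀ {P E N D t} .{{_ : NonZero E}} .{{_ : NonZero D}} → P * D < N * E → N * E * D ≤ t →
  P * t / E ≤ N * (t / D)
P*t/E≤N*[t/D] {P} {E} {N} {D} {t} PD<NE NED≤t = begin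
  P * t / E      ≤⟨ /-monoˡ-≤ E Pt≤NsE ⟩
  N * s * E / E  ≡⟨ m*n/n≡m (N * s) E ⟩
  N * s          ∎
  where
  open ℕ.≤-Reasoning
  s = t / D
  t<D+sD : t < D + s * D
  t<D+sD = ℕ.≤-trans (s≤s (ℕ.≤-reflexive (m≡m%n+[m/n]*n t D))) (ℕ.+-monoˡ-≤ (s * D) (m%n<n t D))
  expand : ∀ P D t N E → t + (P * D * t + N * E) ≡ suc (P * D) * t + N * E
  expand = solve-∀
  collect : ∀ N E t → N * E * t + N * E ≡ N * E * suc t
  collect = solve-∀
  PDt≤NEsD : P * D * t ≤ N * E * (s * D)
  PDt≤NEsD = ℕ.m+n≤o⇒m≤o (P * D * t) (ℕ.+-cancelˡ-≤ t _ _ (begin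
    t + (P * D * t + N * E)      ≡⟨ expand P D t N E ⟩
    suc (P * D) * t + N * E      ≤⟨ ℕ.+-monoˡ-≤ (N * E) (ℕ.*-monoˡ-≤ t PD<NE) ⟩
    N * E * t + N * E            ≡⟨ collect N E t ⟩
    N * E * suc t                ≤⟨ ℕ.*-monoʳ-≤ (N * E) t<D+sD ⟩
    N * E * (D + s * D)          ≡⟨ ℕ.*-distribˡ-+ (N * E) D (s * D) ⟩
    N * E * D + N * E * (s * D)  ≤⟨ ℕ.+-monoˡ-≤ (N * E * (s * D)) NED≤t ⟩
    t + N * E * (s * D)          ∎))
  D*Pt≡PDt : ∀ D P t → D * (P * t) ≡ P * D * t
  D*Pt≡PDt = solve-∀
  NEsD≡D*NsE : ∀ N E s D → N * E * (s * D) ≡ D * (N * s * E)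
  NEsD≡D*NsE = solve-∀
  Pt≤NsE : P * t ≤ N * s * E
  Pt≤NsE = ℕ.*-cancelˡ-≤ D (subst₂ _≤_ (sym (D*Pt≡PDt D P t)) (NEsD≡D*NsE N E s D) PDt≤NEsD)

eventually-floor≤ : ∀ k q N .{{_ : NonZero k}} .{{_ : NonZero q}} (c : ℚ) → ℚ.0ℚ ℚ.≤ c →
  c ℚ.< (+ 1 ℚ./ k) ℚ.* (+ N ℚ./ q) →
  ∃[ T ] ∀ t → T ≤ t → ∃[ m ] (floor (c ℚ.* (+ t ℚ./ 1)) ≡ + m × ∃[ a ] (k * a * q ≤ t × m ≤ N * a))
eventually-floor≤ k q N (mkℚ (+ P) E-1 _) _ c<r =
  N * suc E-1 * (k * q) , λ t T≤t →
  P * t / suc E-1 , floor[P/E*t]≡P*t/E P E-1 _ t ,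
  t / (k * q) , ℕ.≤-trans (ℕ.≤-reflexive (regroup k (t / (k * q)) q)) (m/n*n≤m t (k * q)) ,
  P*t/E≤N*[t/D] {P} {suc E-1} {N} {k * q} (P/E<[1/k]*[N/q]⇒P*kq<N*E {k = k} {q} {N} c<r) T≤t
  where
  instance
    kq≢0 : NonZero (k * q)
    kq≢0 = ℕ.m*n≢0 k q
  regroup : ∀ k a q → k * a * q ≡ a * (k * q)
  regroup = solve-∀
eventually-floor≤ k q N (mkℚ -[1+ _ ] _ _) (ℚ.*≤* ()) _

lemma17 : (H : Graph) (q : ℕ) .{{_ : NonZero q}} (X : List (BV H q)) →
    Unique X → MatchingLinked (blowup H q) X →
    γ≥ H ((+ 1 ℚ./ 3) ℚ.* (+ length X ℚ./ q))
lemma17 H q X uX linked c 0<c c<r with ℚ.<-dense c<r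
... | c′ , c<c′ , c′<r = c′ , c<c′ , admissible
  where
  admissible : Admissible H c′
  admissible with eventually-floor≤ 3 q (length X) c′ (ℚ.<⇒≤ (ℚ.<-trans 0<c c<c′)) c′<r
  ... | T , floor≤ = T , λ t T≤t → sized t (floor≤ t T≤t)
    where
    sized : ∀ t → ∃[ m ] (floor (c′ ℚ.* (+ t ℚ./ 1)) ≡ + m × ∃[ a ] (3 * a * q ≤ t × m ≤ length X * a)) →
      ∃[ Y ] (Unique Y × MatchingLinked (blowup H t) Y × + length Y ≡ floor (c′ ℚ.* (+ t ℚ./ 1)))
    sized t (m , ⌊c′t⌋≡m , a , 3aq≤t , m≤|X|a) with blowup-matchingLinked H uX linked 3aq≤t
    ... | Y , uY , linkedY , |Y|≡|X|a =
      take m Y , Unique.take⁺ m uY , MatchingLinked-⊆ (Any-resp-⊆ (take-⊆ m Y)) linkedY ,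
      ≡.trans (cong +_ (≡.trans (length-take m Y) (ℕ.m≤n⇒m⊓n≡m (subst (m ≤_) (sym |Y|≡|X|a) m≤|X|a))))
              (sym ⌊c′t⌋≡m)
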